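{- Fix $k\ge2$. For all $n\ge0$, $0\le m\le n$, $0\le a\le k-1$ and $1\le r\le k-1$, $F^{k,a,r}_{n,m}=M^{k-1}_{n,m}(\vec\alpha,\vec\beta)$, where $\vec\alpha=(\alpha_0,\dots,\alpha_{k-2})$, $\vec\beta=(\beta_0,\dots,\beta_{k-2})$ with $$\alpha_i=\binom{k}{i+1}-\binom{k-a-1}{i+1}-\binom{k-r-1}{i},\qquad \beta_i=\binom{k}{i+1}\qquad(0\le i\le k-2).$$
   Context: For $k\ge2$, $a\ge0$ and $1\le r\le k-1$, $F^{k,a,r}_{n,m}$ is the number of integer lattice paths from $(0,0)$ to $(kn,km)$ using steps $U=(1,1)$ and $D_{k-1}=(1,1-k)$ that stay weakly above the line $y=-a$ and contain no subpath of the form $U^rD_{k-1}$ ($r$ consecutive $U$ steps followed by a $D_{k-1}$ step) ending at height $0$. An order-$\ell$ Motzkin path of length $n$ and height $m$ is an integer lattice path from $(0,0)$ to $(n,m)$ using steps $U=(1,1)$ and $D_i=(1,-i)$ for $0\le i\le \ell$, never going below $y=0$. For $\ell$-tuples of non-negative integers $\vec\alpha=(\alpha_0,\dots,\alpha_{\ell-1}),\vec\beta=(\beta_0,\dots,\beta_{\ell-1})$, an $(\vec\alpha,\vec\beta)$-colored Motzkin path is such a path in which, for each $0\le i\le \ell-1$, each $D_i$ step whose right endpoint is at height $0$ is labeled by one of $\alpha_i$ colors and each $D_i$ step whose right endpoint is at height $>0$ is labeled by one of $\beta_i$ colors; $U$ and $D_\ell$ steps are unlabeled. $M^\ell_{n,m}(\vec\alpha,\vec\beta)$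 is the number of such colored paths of length $n$ and height $m$. Binomial coefficients $\binom{p}{q}$ with $q>p\ge0$ are $0$. -}

module Defs where

open import Data.Nat as ℕ using (ℕ; zero; suc; _∸_)
open import Data.Nat.Combinatorics using (_C_)
open import Data.Integer as ℤ using (ℤ; +_; _-_; _≤ᵇ_)
open import Data.Bool using (Bool; true; false; _∧_; _∨_; not; if_then_else_)
open import Data.List using (List; []; _∷_; map; concatMap; filter; length; inits; reverse; replicate; _++_)
open import Data.Bool.ListAction using (all; any)
open import Relation.Nullary using (yes; no)
open import Data.Bool.Properties renaming (_≟_ to _≟b_)
open import Data.Fin using (Fin; toℕ; fromℕ<)
open import Data.List.Base using (allFin)
open import Relation.Nullary.Decidable using (does)
open import Data.Nat.Properties using (≤-refl)

words : {A : Set} → List A → ℕ → List (List A)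
words as zero    = [] ∷ []
words as (suc L) = concatMap (λ s → map (s ∷_) (words as L)) as

-- Paths with steps U = (1,1) and D_{k-1} = (1,1-k)

data FStep : Set where
  U D : FStep

fStep-dy : ℕ → FStep → ℤ
fStep-dy k U = + 1
fStep-dy k D = + 1 - + k

fHeight : ℕ → List FStep → ℤ
fHeight k []       = + 0
fHeight k (s ∷ ss) = fStep-dy k s ℤ.+ fHeight k ss

eqStep : FStep → FStep → Bool
eqStep U U = true
eqStep D D = true
eqStep _ _ = false

eqSteps : List FStep → List FStep → Bool
eqSteps []       []       = true
eqSteps (x ∷ xs) (y ∷ ys) = eqStep x y ∧ eqSteps xs ys
eqSteps _        _        = false

endsWith : List FStep → List FStep → Bool
endsWith p suf = startsWith (reverse p) (reverse suf)
  where
  startsWith : List FStep → List FStep → Bool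
  startsWith xs       []       = true
  startsWith []       (_ ∷ _)  = false
  startsWith (x ∷ xs) (y ∷ ys) = eqStep x y ∧ startsWith xs ys

ℤeq : ℤ → ℤ → Bool
ℤeq x y = does (x ℤ.≟ y)

-- A path w (list of steps, starting at (0,0)) is counted by F^{k,a,r}_{n,m} iff
--  * it has kn steps (so it ends at x = kn) and ends at height km,
--  * every vertex (endpoint of every prefix) has height ≥ -a,
--  * no prefix p ends with U^r D_{k-1} while ending at height 0
--    (i.e. no subpath U^r D_{k-1} ending at height 0).
isFPath : (k a r n m : ℕ) → List FStep → Bool
isFPath k a r n m w =
  does (length w ℕ.≟ k ℕ.* n)
  ∧ ℤeq (fHeight k w) (+ (k ℕ.* m))
  ∧ all (λ p → ℤ.- (+ a) ≤ᵇ fHeight k p) (inits w)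
  ∧ not (any (λ p → endsWith p (replicate r U ++ (D ∷ [])) ∧ ℤeq (fHeight k p) (+ 0)) (inits w))

F : (k a r n m : ℕ) → ℕ
F k a r n m = length (filter (λ w → isFPath k a r n m w ≟b true) (words (U ∷ D ∷ []) (k ℕ.* n)))

-- Order-ℓ Motzkin paths: steps U = (1,1) and D_i = (1,-i), 0 ≤ i ≤ ℓ

data MStep (ℓ : ℕ) : Set where
  up   : MStep ℓ
  down : Fin (suc ℓ) → MStep ℓ

mSteps : (ℓ : ℕ) → List (MStep ℓ)
mSteps ℓ = up ∷ map down (allFin (suc ℓ))

mStep-dy : {ℓ : ℕ} → MStep ℓ → ℤ
mStep-dy up       = + 1
mStep-dy (down i) = ℤ.- (+ toℕ i)

mValid : {ℓ : ℕ} → ℤ → List (MStep ℓ) → Bool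
mValid h []       = true
mValid h (s ∷ ss) = (+ 0 ≤ᵇ (h ℤ.+ mStep-dy s)) ∧ mValid (h ℤ.+ mStep-dy s) ss

mHeight : {ℓ : ℕ} → List (MStep ℓ) → ℤ
mHeight []       = + 0
mHeight (s ∷ ss) = mStep-dy s ℤ.+ mHeight ss

isMPath : (ℓ n m : ℕ) → List (MStep ℓ) → Bool
isMPath ℓ n m w = does (length w ℕ.≟ n) ∧ mValid (+ 0) w ∧ ℤeq (mHeight w) (+ m)

-- number of colours available for a step whose right endpoint is at height h':
-- D_i with i < ℓ: α_i colours if h' = 0, β_i colours if h' > 0;
-- U and D_ℓ: unlabelled (factor 1).
stepWeight : {ℓ : ℕ} → (α β : Fin ℓ → ℤ) → ℤ → MStep ℓ → ℤ
stepWeight         α β h' up = + 1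
stepWeight {ℓ} α β h' (down i) with toℕ i ℕ.<? ℓ
... | yes i<ℓ = if ℤeq h' (+ 0) then α (fromℕ< i<ℓ) else β (fromℕ< i<ℓ)
... | no _    = + 1

colourings : {ℓ : ℕ} → (α β : Fin ℓ → ℤ) → ℤ → List (MStep ℓ) → ℤ
colourings α β h []       = + 1
colourings α β h (s ∷ ss) =
  stepWeight α β (h ℤ.+ mStep-dy s) s ℤ.* colourings α β (h ℤ.+ mStep-dy s) ss

sumℤ : List ℤ → ℤ
sumℤ []       = + 0
sumℤ (x ∷ xs) = x ℤ.+ sumℤ xs

M : (ℓ : ℕ) → (α β : Fin ℓ → ℤ) → (n m : ℕ) → ℤ
M ℓ α β n m =
  sumℤ (map (λ w → if isMPath ℓ n m w then colourings α β (+ 0) w else + 0) (words (mSteps ℓ) n))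

αvec : (k a r : ℕ) → Fin (k ∸ 1) → ℤ
αvec k a r i = + (k C (suc (toℕ i))) - + ((k ∸ a ∸ 1) C (suc (toℕ i))) - + ((k ∸ r ∸ 1) C toℕ i)

βvec : (k : ℕ) → Fin (k ∸ 1) → ℤ
βvec k i = + (k C (suc (toℕ i)))

-- Both sides satisfy the same first-step recursion once an F-path is cut into blocks of k
-- steps. Every step changes the height by 1 modulo k, so block boundaries lie at heights kH,
-- and a block from kH to k(H − i) contains exactly i + 1 D-steps: it plays the role of the
-- Motzkin step D_i (of U when it has no D-step). If H − i > 0 no vertex of the block can violate
-- a constraint, so there are C(k, i+1) = β_i such blocks. If the block ends at height 0, one
-- removes from the C(k, i+1) candidates the C(k−a−1, i+1) that dip below −a and the C(k−r−1, i)
-- that complete U^r D at height 0, leaving α_i (and 1 for the unlabelled D_{k−1}); this count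
-- does not depend on how the previous block ended. Hence counting F-paths block by block is the
-- recursion that counts coloured Motzkin paths step by step, and induction on n concludes.

module Submission where

open import Defs
open import Algebra.Core using (Op₂)
open import Algebra.Structures using (IsMonoid)
open import Data.Bool using (Bool; true; false; T; _∧_; not; if_then_else_)
open import Data.Bool.ListAction using (all; any)
open import Data.Bool.Properties using (∧-assoc; ∧-comm; ∧-identityʳ; ∧-zeroʳ) renaming (_≟_ to _≟ᵇ_)
open import Data.Fin as Fin using (Fin; toℕ; fromℕ<)
open import Data.Fin.Properties using (toℕ-fromℕ<; toℕ<n)
open import Data.Integer as ℤ using (ℤ; +_; -[1+_]; _-_)
import Data.Integer.Properties as ℤP
import Data.Integer.Tactic.RingSolver as ℤSolver
open import Data.List using (List; []; _∷_; _++_; _∷ʳ_; [_]; map; concatMap; filter; foldr; length; inits; reverse; replicate; tabulate; allFin)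
open import Data.List.Properties using (++-assoc; ++-identityʳ; map-∘; map-cong; map-id; unfold-reverse; reverse-++; reverse-involutive)
open import Data.Nat as ℕ using (ℕ; zero; suc; _+_; _*_; _∸_; _≤_; _<_; _≤ᵇ_; s≤s; z≤n)
open import Data.Nat.Combinatorics using (_C_; nCn≡1; k>n⇒nCk≡0; nCk≡nC[n∸k]; nCk+nC[k+1]≡[n+1]C[k+1])
import Data.Nat.Properties as ℕP
open import Algebra.Properties.CommutativeSemigroup ℕP.+-commutativeSemigroup using (interchange; xy∙z≈xz∙y)
open import Data.Sum using (_⊎_; inj₁; inj₂)
open import Function using (_∘_)
open import Relation.Binary.Definitions using (tri<; tri≈; tri>)
open import Relation.Binary.PropositionalEquality hiding ([_])
open import Relation.Nullary using (¬_; yes; no; contradiction)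
open import Relation.Nullary.Decidable using (dec-true; dec-false)

module SumsOverWords {c} {R : Set c} {_∙_ : Op₂ R} {ε : R} (isMonoid : IsMonoid _≡_ _∙_ ε) where

  open IsMonoid isMonoid using (assoc; identityˡ)

  sumOver : {A : Set} → (A → R) → List A → R
  sumOver f = foldr (λ x s → f x ∙ s) ε

  sumOver-++ : {A : Set} (f : A → R) (xs ys : List A) → sumOver f (xs ++ ys) ≡ sumOver f xs ∙ sumOver f ys
  sumOver-++ f []       ys = sym (identityˡ _)
  sumOver-++ f (x ∷ xs) ys = trans (cong (f x ∙_) (sumOver-++ f xs ys)) (sym (assoc _ _ _))

  sumOver-cong : {A : Set} {f g : A → R} → (∀ x → f x ≡ g x) → (xs : List A) → sumOver f xs ≡ sumOver g xs
  sumOver-cong f≗g []       = refl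
  sumOver-cong f≗g (x ∷ xs) = cong₂ _∙_ (f≗g x) (sumOver-cong f≗g xs)

  sumOver-map : {A B : Set} (f : A → R) (g : B → A) (xs : List B) → sumOver f (map g xs) ≡ sumOver (f ∘ g) xs
  sumOver-map f g []       = refl
  sumOver-map f g (x ∷ xs) = cong (f (g x) ∙_) (sumOver-map f g xs)

  sumOver-words-suc : {A : Set} (as : List A) (L : ℕ) (f : List A → R) →
    sumOver f (words as (suc L)) ≡ sumOver (λ a → sumOver (f ∘ (a ∷_)) (words as L)) as
  sumOver-words-suc {A} as L f = go as
    where
    go : (bs : List A) →
      sumOver f (concatMap (λ b → map (b ∷_) (words as L)) bs) ≡ sumOver (λ a → sumOver (f ∘ (a ∷_)) (words as L)) bs
    go []       = refl
    go (b ∷ bs) = trans (sumOver-++ f (map (b ∷_) (words as L)) _) (cong₂ _∙_ (sumOver-map f (b ∷_) (words as L)) (go bs))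

  sumOver-words-cong : {A : Set} (as : List A) (L : ℕ) {f g : List A → R} →
    (∀ w → length w ≡ L → f w ≡ g w) → sumOver f (words as L) ≡ sumOver g (words as L)
  sumOver-words-cong as zero    f≗g = cong (_∙ ε) (f≗g [] refl)
  sumOver-words-cong as (suc L) f≗g =
    trans (sumOver-words-suc as L _)
      (trans (sumOver-cong (λ a → sumOver-words-cong as L (λ w → f≗g (a ∷ w) ∘ cong suc)) as)
        (sym (sumOver-words-suc as L _)))

module ℕSum = SumsOverWords ℕP.+-0-isMonoid
module ℤSum = SumsOverWords ℤP.+-0-isMonoid

open ℕSum using () renaming (sumOver to Σℕ)
open ℤSum using () renaming (sumOver to Σℤ)

≤ᵇ-suc : ∀ m n → (suc m ≤ᵇ suc n) ≡ (m ≤ᵇ n)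
≤ᵇ-suc zero    n = refl
≤ᵇ-suc (suc m) n = refl

suc-≤ᵇ : ∀ m n → (suc m ≤ᵇ n) ≡ not (n ≤ᵇ m)
suc-≤ᵇ m       zero    = refl
suc-≤ᵇ zero    (suc n) = refl
suc-≤ᵇ (suc m) (suc n) = trans (≤ᵇ-suc (suc m) n) (trans (suc-≤ᵇ m n) (cong not (sym (≤ᵇ-suc n m))))

≤⇒≤ᵇ≡true : ∀ {m n} → m ≤ n → (m ≤ᵇ n) ≡ true
≤⇒≤ᵇ≡true {zero}  _         = refl
≤⇒≤ᵇ≡true {suc m} (s≤s m≤n) = trans (≤ᵇ-suc m _) (≤⇒≤ᵇ≡true m≤n)

≤ᵇ≡false : ∀ {m n} → n < m → (m ≤ᵇ n) ≡ false
≤ᵇ≡false {suc m} {zero}  _         = refl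
≤ᵇ≡false {suc m} {suc n} (s≤s n<m) = trans (≤ᵇ-suc m n) (≤ᵇ≡false n<m)

∸≡suc∸suc : ∀ {x s} → x < s → s ∸ x ≡ suc (s ∸ suc x)
∸≡suc∸suc {zero}  {suc s} _         = refl
∸≡suc∸suc {suc x} {suc s} (s≤s x<s) = ∸≡suc∸suc x<s

suc-∸ : ∀ x y → suc x ∸ y ≡ (x ∸ y) + (if y ≤ᵇ x then 1 else 0)
suc-∸ x       zero    = ℕP.+-comm 1 x
suc-∸ zero    (suc y) = ℕP.0∸n≡0 y
suc-∸ (suc x) (suc y) = trans (suc-∸ x y) (cong (λ b → (x ∸ y) + (if b then 1 else 0)) (sym (≤ᵇ-suc y x)))

sumBelow : ℕ → (ℕ → ℕ) → ℕ
sumBelow zero    f = 0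
sumBelow (suc n) f = f 0 + sumBelow n (f ∘ suc)

sumBelow-cong : ∀ n {f g : ℕ → ℕ} → (∀ i → i < n → f i ≡ g i) → sumBelow n f ≡ sumBelow n g
sumBelow-cong zero    f≗g = refl
sumBelow-cong (suc n) f≗g = cong₂ _+_ (f≗g 0 (s≤s z≤n)) (sumBelow-cong n (λ i i<n → f≗g (suc i) (s≤s i<n)))

sumBelow-+ : ∀ n (f g : ℕ → ℕ) → sumBelow n (λ i → f i + g i) ≡ sumBelow n f + sumBelow n g
sumBelow-+ zero    f g = refl
sumBelow-+ (suc n) f g = trans (cong (f 0 + g 0 ℕ.+_) (sumBelow-+ n (f ∘ suc) (g ∘ suc))) (interchange (f 0) (g 0) _ _)

sumBelow-suc : ∀ n (f : ℕ → ℕ) → sumBelow (suc n) f ≡ sumBelow n f + f n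
sumBelow-suc zero    f = ℕP.+-comm (f 0) 0
sumBelow-suc (suc n) f = trans (cong (f 0 ℕ.+_) (sumBelow-suc n (f ∘ suc))) (sym (ℕP.+-assoc (f 0) _ _))

sumBelow-vanishing : ∀ {n N} (f : ℕ → ℕ) → n ≤ N → (∀ i → n ≤ i → f i ≡ 0) → sumBelow N f ≡ sumBelow n f
sumBelow-vanishing {n} {N} f n≤N f≡0 = trans (cong (λ M → sumBelow M f) (sym (ℕP.m+[n∸m]≡n n≤N))) (extend n (N ∸ n) f f≡0)
  where
  extend : ∀ n d (f : ℕ → ℕ) → (∀ i → n ≤ i → f i ≡ 0) → sumBelow (n + d) f ≡ sumBelow n f
  extend zero    zero    f f≡0 = refl
  extend zero    (suc d) f f≡0 =
    trans (cong (_+ sumBelow d (f ∘ suc)) (f≡0 0 z≤n)) (extend zero d (f ∘ suc) (λ i _ → f≡0 (suc i) z≤n))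
  extend (suc n) d       f f≡0 = cong (f 0 ℕ.+_) (extend n d (f ∘ suc) (λ i n≤i → f≡0 (suc i) (s≤s n≤i)))

-- Pascal's rule as the definition, so that it unfolds in inductions on the number of steps.
choose : ℕ → ℕ → ℕ
choose s       zero    = 1
choose zero    (suc e) = 0
choose (suc s) (suc e) = choose s (suc e) + choose s e

choose≡C : ∀ s e → choose s e ≡ s C e
choose≡C s       zero    = sym (trans (nCk≡nC[n∸k] {0} {s} z≤n) (nCn≡1 s))
choose≡C zero    (suc e) = sym (k>n⇒nCk≡0 {0} {suc e} (s≤s z≤n))
choose≡C (suc s) (suc e) = trans (cong₂ _+_ (choose≡C s (suc e)) (choose≡C s e))
                                 (trans (ℕP.+-comm (s C suc e) (s C e)) (nCk+nC[k+1]≡[n+1]C[k+1] s e))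

choose-< : ∀ {s e} → s < e → choose s e ≡ 0
choose-< {zero}  {suc e} _           = refl
choose-< {suc s} {suc e} (s≤s s<e) = cong₂ _+_ (choose-< (ℕP.m<n⇒m<1+n s<e)) (choose-< s<e)

choose-1 : ∀ s → choose s 1 ≡ s
choose-1 zero    = refl
choose-1 (suc s) = trans (cong (_+ 1) (choose-1 s)) (ℕP.+-comm s 1)

choose-n-n : ∀ n → choose n n ≡ 1
choose-n-n zero    = refl
choose-n-n (suc n) = cong₂ _+_ (choose-< (ℕP.n<1+n n)) (choose-n-n n)

choose-∸-suc : ∀ x y e → choose (x ∸ y) (suc (suc e)) ≡ choose (x ∸ suc y) (suc (suc e)) + choose (x ∸ suc y) (suc e)
choose-∸-suc zero    zero    e = refl
choose-∸-suc (suc x) zero    e = refl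
choose-∸-suc zero    (suc y) e = refl
choose-∸-suc (suc x) (suc y) e = choose-∸-suc x y e

sumBelow-0 : ∀ n → sumBelow n (λ _ → 0) ≡ 0
sumBelow-0 zero    = refl
sumBelow-0 (suc n) = sumBelow-0 n

-- F-paths as the runs of an automaton

countTrue : {A : Set} → (A → Bool) → List A → ℕ
countTrue p = Σℕ (λ x → if p x then 1 else 0)

length-filter-≟true : {A : Set} (p : A → Bool) (xs : List A) →
  length (filter (λ x → p x ≟ᵇ true) xs) ≡ countTrue p xs
length-filter-≟true p []       = refl
length-filter-≟true p (x ∷ xs) with p x
... | true  = cong suc (length-filter-≟true p xs)
... | false = length-filter-≟true p xs

countTrue-∧ : {A : Set} (v : Bool) (q : A → Bool) (xs : List A) →
  countTrue (λ x → v ∧ q x) xs ≡ (if v then countTrue q xs else 0)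
countTrue-∧ true  q xs       = refl
countTrue-∧ false q []       = refl
countTrue-∧ false q (x ∷ xs) = countTrue-∧ false q xs

all∧not-any : {A : Set} (p q : A → Bool) (xs : List A) →
  all p xs ∧ not (any q xs) ≡ all (λ x → p x ∧ not (q x)) xs
all∧not-any p q []       = refl
all∧not-any p q (x ∷ xs) with p x | q x
... | false | _     = refl
... | true  | true  = ∧-zeroʳ _
... | true  | false = all∧not-any p q xs

replicate-suc-∷ʳ : {A : Set} (x : A) (r : ℕ) → replicate (suc r) x ≡ replicate r x ∷ʳ x
replicate-suc-∷ʳ x zero    = refl
replicate-suc-∷ʳ x (suc r) = cong (x ∷_) (replicate-suc-∷ʳ x r)

leadingUs : List FStep → ℕ
leadingUs (U ∷ xs) = suc (leadingUs xs)
leadingUs _        = 0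

trailingUs : List FStep → ℕ
trailingUs = leadingUs ∘ reverse

endsWith-∷ʳ : ∀ xs x ys y → endsWith (xs ∷ʳ x) (ys ∷ʳ y) ≡ eqStep x y ∧ endsWith xs ys
endsWith-∷ʳ xs x ys y rewrite reverse-++ xs [ x ] | reverse-++ ys [ y ] = refl

[]-endsWith-∷ʳ : ∀ ys y → endsWith [] (ys ∷ʳ y) ≡ false
[]-endsWith-∷ʳ ys y rewrite reverse-++ ys [ y ] = refl

endsWith-replicate-U : ∀ r t → endsWith (reverse t) (replicate r U) ≡ (r ≤ᵇ leadingUs t)
endsWith-replicate-U zero    t = refl
endsWith-replicate-U (suc r) t = trans (cong (endsWith (reverse t)) (replicate-suc-∷ʳ U r)) (go t)
  where
  go : ∀ t → endsWith (reverse t) (replicate r U ∷ʳ U) ≡ (suc r ≤ᵇ leadingUs t)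
  go []      = []-endsWith-∷ʳ (replicate r U) U
  go (U ∷ t) = begin
    endsWith (reverse (U ∷ t)) (replicate r U ∷ʳ U) ≡⟨ cong (λ z → endsWith z (replicate r U ∷ʳ U)) (unfold-reverse U t) ⟩
    endsWith (reverse t ∷ʳ U) (replicate r U ∷ʳ U)   ≡⟨ endsWith-∷ʳ (reverse t) U (replicate r U) U ⟩
    endsWith (reverse t) (replicate r U)             ≡⟨ endsWith-replicate-U r t ⟩
    (r ≤ᵇ leadingUs t)                                ≡⟨ ≤ᵇ-suc r (leadingUs t) ⟨
    (suc r ≤ᵇ suc (leadingUs t))                      ∎
    where open ≡-Reasoning
  go (D ∷ t) = trans (cong (λ z → endsWith z (replicate r U ∷ʳ U)) (unfold-reverse D t))
                     (endsWith-∷ʳ (reverse t) D (replicate r U) U)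

fHeight-++ : ∀ k p q → fHeight k (p ++ q) ≡ fHeight k p ℤ.+ fHeight k q
fHeight-++ k []       q = sym (ℤP.+-identityˡ _)
fHeight-++ k (x ∷ p)  q =
  trans (cong (λ z → fStep-dy k x ℤ.+ z) (fHeight-++ k p q)) (sym (ℤP.+-assoc (fStep-dy k x) (fHeight k p) (fHeight k q)))

fHeight-∷ʳ : ∀ k p x → fHeight k (p ∷ʳ x) ≡ fHeight k p ℤ.+ fStep-dy k x
fHeight-∷ʳ k p x = trans (fHeight-++ k p [ x ]) (cong (λ z → fHeight k p ℤ.+ z) (ℤP.+-identityʳ _))

module FPaths (k a r m : ℕ) where

  forbidden : List FStep
  forbidden = replicate r U ++ [ D ]

  admissible : ℤ → Bool → Bool
  admissible h b = (ℤ.- (+ a) ℤ.≤ᵇ h) ∧ not (b ∧ ℤeq h (+ 0))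

  runAfter : FStep → ℕ → ℕ
  runAfter U c = suc c
  runAfter D c = 0

  completesForbidden : FStep → ℕ → Bool
  completesForbidden U c = false
  completesForbidden D c = r ≤ᵇ c

  goal : ℤ
  goal = + (k * m)

  -- The state after a prefix: its height, its number of trailing U-steps, and whether it ends
  -- with the forbidden pattern.
  accepts : ℤ → ℕ → Bool → List FStep → Bool
  accepts h c b []      = admissible h b ∧ ℤeq h goal
  accepts h c b (x ∷ w) = admissible h b ∧ accepts (h ℤ.+ fStep-dy k x) (runAfter x c) (completesForbidden x c) w

  admissiblePrefix : List FStep → Bool
  admissiblePrefix p = admissible (fHeight k p) (endsWith p forbidden)

  trailingUs-∷ʳ : ∀ p x → trailingUs (p ∷ʳ x) ≡ runAfter x (trailingUs p)
  trailingUs-∷ʳ p x = trans (cong leadingUs (reverse-++ p [ x ])) (leadingUs-∷ x)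
    where
    leadingUs-∷ : ∀ x → leadingUs (x ∷ reverse p) ≡ runAfter x (trailingUs p)
    leadingUs-∷ U = refl
    leadingUs-∷ D = refl

  endsWith-forbidden-∷ʳ : ∀ p x → endsWith (p ∷ʳ x) forbidden ≡ completesForbidden x (trailingUs p)
  endsWith-forbidden-∷ʳ p x = trans (endsWith-∷ʳ p x (replicate r U) D) (completes x)
    where
    completes : ∀ x → eqStep x D ∧ endsWith p (replicate r U) ≡ completesForbidden x (trailingUs p)
    completes U = refl
    completes D = trans (cong (λ q → endsWith q (replicate r U)) (sym (reverse-involutive p)))
                        (endsWith-replicate-U r (reverse p))

  prefixState-accepts : ∀ p w →
    all admissiblePrefix (map (p ++_) (inits w)) ∧ ℤeq (fHeight k (p ++ w)) goal
      ≡ accepts (fHeight k p) (trailingUs p) (endsWith p forbidden) w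
  prefixState-accepts p [] rewrite ++-identityʳ p = cong (_∧ ℤeq (fHeight k p) goal) (∧-identityʳ (admissiblePrefix p))
  prefixState-accepts p (x ∷ w) = begin
    (admissiblePrefix (p ++ []) ∧ all admissiblePrefix (map (p ++_) (map (x ∷_) (inits w)))) ∧ ℤeq (fHeight k (p ++ x ∷ w)) goal
      ≡⟨ cong₂ (λ q qs → (admissiblePrefix q ∧ all admissiblePrefix qs) ∧ ℤeq (fHeight k (p ++ x ∷ w)) goal)
               (++-identityʳ p) (trans (sym (map-∘ (inits w))) (map-cong (λ q → sym (++-assoc p [ x ] q)) (inits w))) ⟩
    (admissiblePrefix p ∧ rest) ∧ ℤeq (fHeight k (p ++ x ∷ w)) goal
      ≡⟨ cong (λ q → (admissiblePrefix p ∧ rest) ∧ ℤeq (fHeight k q) goal) (sym (++-assoc p [ x ] w)) ⟩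
    (admissiblePrefix p ∧ rest) ∧ ℤeq (fHeight k ((p ∷ʳ x) ++ w)) goal
      ≡⟨ ∧-assoc (admissiblePrefix p) rest _ ⟩
    admissiblePrefix p ∧ (rest ∧ ℤeq (fHeight k ((p ∷ʳ x) ++ w)) goal)
      ≡⟨ cong (admissiblePrefix p ∧_) (prefixState-accepts (p ∷ʳ x) w) ⟩
    admissiblePrefix p ∧ accepts (fHeight k (p ∷ʳ x)) (trailingUs (p ∷ʳ x)) (endsWith (p ∷ʳ x) forbidden) w
      ≡⟨ cong (λ h → admissiblePrefix p ∧ accepts h (trailingUs (p ∷ʳ x)) (endsWith (p ∷ʳ x) forbidden) w) (fHeight-∷ʳ k p x) ⟩
    admissiblePrefix p ∧ accepts (fHeight k p ℤ.+ fStep-dy k x) (trailingUs (p ∷ʳ x)) (endsWith (p ∷ʳ x) forbidden) w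
      ≡⟨ cong₂ (λ c b → admissiblePrefix p ∧ accepts (fHeight k p ℤ.+ fStep-dy k x) c b w)
               (trailingUs-∷ʳ p x) (endsWith-forbidden-∷ʳ p x) ⟩
    admissiblePrefix p ∧ accepts (fHeight k p ℤ.+ fStep-dy k x) (runAfter x (trailingUs p)) (completesForbidden x (trailingUs p)) w
      ∎
    where
    open ≡-Reasoning
    rest : Bool
    rest = all admissiblePrefix (map ((p ∷ʳ x) ++_) (inits w))

  isFPath≡accepts : ∀ n w → length w ≡ k * n → isFPath k a r n m w ≡ accepts (+ 0) 0 false w
  isFPath≡accepts n w |w| = begin
    isFPath k a r n m w
      ≡⟨ cong (_∧ (reachesGoal ∧ (all P (inits w) ∧ not (any Q (inits w))))) (dec-true (length w ℕ.≟ k * n) |w|) ⟩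
    reachesGoal ∧ (all P (inits w) ∧ not (any Q (inits w)))
      ≡⟨ cong (reachesGoal ∧_) (all∧not-any P Q (inits w)) ⟩
    reachesGoal ∧ all admissiblePrefix (inits w)
      ≡⟨ ∧-comm reachesGoal _ ⟩
    all admissiblePrefix (inits w) ∧ reachesGoal
      ≡⟨ cong (λ qs → all admissiblePrefix qs ∧ reachesGoal) (sym (map-id (inits w))) ⟩
    all admissiblePrefix (map ([] ++_) (inits w)) ∧ ℤeq (fHeight k ([] ++ w)) goal
      ≡⟨ prefixState-accepts [] w ⟩
    accepts (+ 0) 0 (endsWith [] forbidden) w
      ≡⟨ cong (λ b → accepts (+ 0) 0 b w) ([]-endsWith-∷ʳ (replicate r U) D) ⟩
    accepts (+ 0) 0 false w
      ∎
    where
    open ≡-Reasoning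
    reachesGoal : Bool
    reachesGoal = ℤeq (fHeight k w) goal
    P Q : List FStep → Bool
    P q = ℤ.- (+ a) ℤ.≤ᵇ fHeight k q
    Q q = endsWith q forbidden ∧ ℤeq (fHeight k q) (+ 0)

  -- The number of accepted continuations of length L from state (h, c, b); `extensions`
  -- omits the admissibility check of the current vertex.
  extensions : ℤ → ℕ → ℕ → ℕ
  admissibleExtensions : ℤ → ℕ → Bool → ℕ → ℕ

  extensions h c zero    = if ℤeq h goal then 1 else 0
  extensions h c (suc L) =
    admissibleExtensions (h ℤ.+ fStep-dy k U) (runAfter U c) (completesForbidden U c) L
    + admissibleExtensions (h ℤ.+ fStep-dy k D) (runAfter D c) (completesForbidden D c) L

  admissibleExtensions h c b L = if admissible h b then extensions h c L else 0

  countTrue-accepts : ∀ h c b L → countTrue (accepts h c b) (words (U ∷ D ∷ []) L) ≡ admissibleExtensions h c b L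
  countTrue-accepts h c b zero with admissible h b
  ... | true  = ℕP.+-identityʳ _
  ... | false = refl
  countTrue-accepts h c b (suc L) = begin
    countTrue (accepts h c b) (words (U ∷ D ∷ []) (suc L))
      ≡⟨ ℕSum.sumOver-words-suc (U ∷ D ∷ []) L _ ⟩
    countTrue (λ w → v ∧ accepts (h ℤ.+ fStep-dy k U) (suc c) false w) (words (U ∷ D ∷ []) L)
      + (countTrue (λ w → v ∧ accepts (h ℤ.+ fStep-dy k D) 0 (r ≤ᵇ c) w) (words (U ∷ D ∷ []) L) + 0)
      ≡⟨ cong₂ (λ x y → x + (y + 0)) (countTrue-∧ v _ (words (U ∷ D ∷ []) L)) (countTrue-∧ v _ (words (U ∷ D ∷ []) L)) ⟩
    (if v then countTrue (accepts (h ℤ.+ fStep-dy k U) (suc c) false) (words (U ∷ D ∷ []) L) else 0)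
      + ((if v then countTrue (accepts (h ℤ.+ fStep-dy k D) 0 (r ≤ᵇ c)) (words (U ∷ D ∷ []) L) else 0) + 0)
      ≡⟨ guard v (countTrue-accepts _ _ _ L) (countTrue-accepts _ _ _ L) ⟩
    admissibleExtensions h c b (suc L)
      ∎
    where
    open ≡-Reasoning
    v : Bool
    v = admissible h b
    guard : ∀ v {x y x′ y′} → x ≡ x′ → y ≡ y′ →
      (if v then x else 0) + ((if v then y else 0) + 0) ≡ (if v then x′ + y′ else 0)
    guard true {x} {y} refl refl = cong (x ℕ.+_) (ℕP.+-identityʳ y)
    guard false _    _    = refl

  F≡extensions : ∀ n → F k a r n m ≡ extensions (+ 0) 0 (k * n)
  F≡extensions n = begin
    F k a r n m
      ≡⟨ length-filter-≟true (isFPath k a r n m) (words (U ∷ D ∷ []) (k * n)) ⟩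
    countTrue (isFPath k a r n m) (words (U ∷ D ∷ []) (k * n))
      ≡⟨ ℕSum.sumOver-words-cong (U ∷ D ∷ []) (k * n) (λ w |w| → cong (λ b → if b then 1 else 0) (isFPath≡accepts n w |w|)) ⟩
    countTrue (accepts (+ 0) 0 false) (words (U ∷ D ∷ []) (k * n))
      ≡⟨ countTrue-accepts (+ 0) 0 false (k * n) ⟩
    admissibleExtensions (+ 0) 0 false (k * n)
      ≡⟨ cong (λ v → if v then extensions (+ 0) 0 (k * n) else 0) (origin-admissible a) ⟩
    extensions (+ 0) 0 (k * n)
      ∎
    where
    open ≡-Reasoning
    origin-admissible : ∀ a → (ℤ.- (+ a) ℤ.≤ᵇ + 0) ∧ true ≡ true
    origin-admissible zero    = refl
    origin-admissible (suc _) = refl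

-- Coloured Motzkin paths by their first step

sumℤ-map : {A : Set} (f : A → ℤ) (xs : List A) → sumℤ (map f xs) ≡ Σℤ f xs
sumℤ-map f []       = refl
sumℤ-map f (x ∷ xs) = cong (λ z → f x ℤ.+ z) (sumℤ-map f xs)

Σℤ-*ˡ : {A : Set} (x : ℤ) (g : A → ℤ) (xs : List A) → Σℤ (λ w → x ℤ.* g w) xs ≡ x ℤ.* Σℤ g xs
Σℤ-*ˡ x g []       = sym (ℤP.*-zeroʳ x)
Σℤ-*ˡ x g (w ∷ xs) = trans (cong (λ z → x ℤ.* g w ℤ.+ z) (Σℤ-*ˡ x g xs)) (sym (ℤP.*-distribˡ-+ x (g w) (Σℤ g xs)))

Σℤ-zero : {A : Set} (xs : List A) → Σℤ (λ _ → + 0) xs ≡ + 0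
Σℤ-zero []       = refl
Σℤ-zero (x ∷ xs) = trans (ℤP.+-identityˡ _) (Σℤ-zero xs)

if-*ˡ : (b : Bool) (x y : ℤ) → (if b then x ℤ.* y else + 0) ≡ x ℤ.* (if b then y else + 0)
if-*ˡ true  x y = refl
if-*ˡ false x y = sym (ℤP.*-zeroʳ x)

module ColouredMotzkinPaths (ℓ m : ℕ) (α β : Fin ℓ → ℤ) where

  weight : ℤ → List (MStep ℓ) → ℤ
  weight h w = if mValid h w ∧ ℤeq (h ℤ.+ mHeight w) (+ m) then colourings α β h w else + 0

  colouredPaths : ℤ → ℕ → ℤ
  colouredPaths h n = Σℤ (weight h) (words (mSteps ℓ) n)

  stepThenPaths : ℤ → ℕ → MStep ℓ → ℤ
  stepThenPaths h n s =
    if + 0 ℤ.≤ᵇ h ℤ.+ mStep-dy s then stepWeight α β (h ℤ.+ mStep-dy s) s ℤ.* colouredPaths (h ℤ.+ mStep-dy s) n else + 0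

  weight-∷ : ∀ h s w → let h′ = h ℤ.+ mStep-dy s in
    weight h (s ∷ w) ≡ (if + 0 ℤ.≤ᵇ h′ then stepWeight α β h′ s ℤ.* weight h′ w else + 0)
  weight-∷ h s w with + 0 ℤ.≤ᵇ h ℤ.+ mStep-dy s
  ... | false = refl
  ... | true rewrite sym (ℤP.+-assoc h (mStep-dy s) (mHeight w)) =
    if-*ˡ (mValid h′ w ∧ ℤeq (h′ ℤ.+ mHeight w) (+ m)) (stepWeight α β h′ s) (colourings α β h′ w)
    where h′ = h ℤ.+ mStep-dy s

  colouredPaths-suc : ∀ h n → colouredPaths h (suc n) ≡ Σℤ (stepThenPaths h n) (mSteps ℓ)
  colouredPaths-suc h n =
    trans (ℤSum.sumOver-words-suc (mSteps ℓ) n (weight h))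
          (ℤSum.sumOver-cong firstStep (mSteps ℓ))
    where
    firstStep : ∀ s → Σℤ (weight h ∘ (s ∷_)) (words (mSteps ℓ) n) ≡ stepThenPaths h n s
    firstStep s = trans (ℤSum.sumOver-cong (weight-∷ h s) ws) (guarded (+ 0 ℤ.≤ᵇ h′))
      where
      h′ = h ℤ.+ mStep-dy s
      x = stepWeight α β h′ s
      ws = words (mSteps ℓ) n
      guarded : ∀ v → Σℤ (λ w → if v then x ℤ.* weight h′ w else + 0) ws ≡ (if v then x ℤ.* colouredPaths h′ n else + 0)
      guarded true  = Σℤ-*ˡ x (weight h′) ws
      guarded false = Σℤ-zero ws

  M≡colouredPaths : ∀ n → M ℓ α β n m ≡ colouredPaths (+ 0) n
  M≡colouredPaths n =
    trans (sumℤ-map _ (words (mSteps ℓ) n)) (ℤSum.sumOver-words-cong (mSteps ℓ) n pathWeight)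
    where
    pathWeight : ∀ w → length w ≡ n → (if isMPath ℓ n m w then colourings α β (+ 0) w else + 0) ≡ weight (+ 0) w
    pathWeight w |w| rewrite dec-true (length w ℕ.≟ n) |w| | ℤP.+-identityˡ (mHeight w) = refl

-- Counting inside one block of k steps

if-*ʳ : (v : Bool) (x g : ℕ) → (if v then x else 0) * g ≡ (if v then x * g else 0)
if-*ʳ true  x g = refl
if-*ʳ false x g = refl

if-split : ∀ v {z x t} → z + x ≡ t → (if v then z else 0) + (if v then x else t) ≡ t
if-split true  z+x≡t = z+x≡t
if-split false _     = refl

module BlockCounts (a r : ℕ) where

  -- Admissibility of a vertex at height kP − s with s < k; it can only fail when P = 0.
  admissibleAt : ℕ → ℕ → Bool → Bool
  admissibleAt (suc P) s       b = true
  admissibleAt zero    zero    b = not b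
  admissibleAt zero    (suc s) b = suc s ≤ᵇ a

  -- inBlock G P c s counts the admissible ways to finish a block from height kP − s with s
  -- steps left and a trailing run of c U-steps, a block ending at height kP′ being weighted
  -- by G P′.
  inBlock : (ℕ → ℕ) → ℕ → ℕ → ℕ → ℕ
  inBlockDown : (ℕ → ℕ) → ℕ → ℕ → ℕ → ℕ

  inBlock G P c zero    = G P
  inBlock G P c (suc s) = (if admissibleAt P s false then inBlock G P (suc c) s else 0) + inBlockDown G P c s

  inBlockDown G zero    c s = 0
  inBlockDown G (suc P) c s = if admissibleAt P s (r ≤ᵇ c) then inBlock G P 0 s else 0

  atZero : ℕ → ℕ
  atZero zero    = 1
  atZero (suc _) = 0

  toZero : ℕ → ℕ → ℕ → ℕ
  toZero = inBlock atZero

  aboveZero : (ℕ → ℕ) → ℕ → ℕ → ℕ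
  aboveZero G zero    s       = 0
  aboveZero G (suc P) zero    = G (suc P)
  aboveZero G (suc P) (suc s) = aboveZero G (suc P) s + aboveZero G P s

  inBlock-level0 : ∀ G c s → inBlock G 0 c s ≡ toZero 0 c s * G 0
  inBlock-level0 G c zero    = sym (ℕP.+-identityʳ (G 0))
  inBlock-level0 G c (suc s) = begin
    (if v then inBlock G 0 (suc c) s else 0) + 0
      ≡⟨ cong (λ x → (if v then x else 0) + 0) (inBlock-level0 G (suc c) s) ⟩
    (if v then toZero 0 (suc c) s * G 0 else 0) + 0
      ≡⟨ cong (_+ 0) (sym (if-*ʳ v (toZero 0 (suc c) s) (G 0))) ⟩
    (if v then toZero 0 (suc c) s else 0) * G 0 + 0
      ≡⟨ ℕP.+-identityʳ (z * G 0) ⟩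
    (if v then toZero 0 (suc c) s else 0) * G 0
      ≡⟨ cong (_* G 0) (sym (ℕP.+-identityʳ z)) ⟩
    ((if v then toZero 0 (suc c) s else 0) + 0) * G 0
      ∎
    where
    open ≡-Reasoning
    v = admissibleAt 0 s false
    z = if v then toZero 0 (suc c) s else 0

  inBlock-decomposition : ∀ G P c s → inBlock G P c s ≡ aboveZero G P s + toZero P c s * G 0
  inBlock-decomposition G zero          c s       = inBlock-level0 G c s
  inBlock-decomposition G (suc P)       c zero    = sym (ℕP.+-identityʳ (G (suc P)))
  inBlock-decomposition G (suc zero)    c (suc s) = begin
    inBlock G 1 (suc c) s + (if v then inBlock G 0 0 s else 0)
      ≡⟨ cong₂ (λ x y → x + (if v then y else 0)) (inBlock-decomposition G 1 (suc c) s) (inBlock-level0 G 0 s) ⟩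
    (aboveZero G 1 s + toZero 1 (suc c) s * G 0) + (if v then toZero 0 0 s * G 0 else 0)
      ≡⟨ cong ((aboveZero G 1 s + toZero 1 (suc c) s * G 0) ℕ.+_) (sym (if-*ʳ v (toZero 0 0 s) (G 0))) ⟩
    (aboveZero G 1 s + toZero 1 (suc c) s * G 0) + (if v then toZero 0 0 s else 0) * G 0
      ≡⟨ ℕP.+-assoc (aboveZero G 1 s) _ _ ⟩
    aboveZero G 1 s + (toZero 1 (suc c) s * G 0 + (if v then toZero 0 0 s else 0) * G 0)
      ≡⟨ cong₂ _+_ (sym (ℕP.+-identityʳ _)) (sym (ℕP.*-distribʳ-+ (G 0) (toZero 1 (suc c) s) _)) ⟩
    aboveZero G 1 (suc s) + toZero 1 c (suc s) * G 0
      ∎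
    where
    open ≡-Reasoning
    v = admissibleAt 0 s (r ≤ᵇ c)
  inBlock-decomposition G (suc (suc P)) c (suc s) = begin
    inBlock G (suc (suc P)) (suc c) s + inBlock G (suc P) 0 s
      ≡⟨ cong₂ _+_ (inBlock-decomposition G (suc (suc P)) (suc c) s) (inBlock-decomposition G (suc P) 0 s) ⟩
    (aboveZero G (suc (suc P)) s + toZero (suc (suc P)) (suc c) s * G 0) + (aboveZero G (suc P) s + toZero (suc P) 0 s * G 0)
      ≡⟨ interchange (aboveZero G (suc (suc P)) s) _ _ _ ⟩
    aboveZero G (suc (suc P)) (suc s) + (toZero (suc (suc P)) (suc c) s * G 0 + toZero (suc P) 0 s * G 0)
      ≡⟨ cong (aboveZero G (suc (suc P)) (suc s) ℕ.+_) (sym (ℕP.*-distribʳ-+ (G 0) (toZero (suc (suc P)) (suc c) s) _)) ⟩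
    aboveZero G (suc (suc P)) (suc s) + toZero (suc (suc P)) c (suc s) * G 0
      ∎
    where open ≡-Reasoning

  aboveZero≡sumBelow : ∀ G P s → aboveZero G P s ≡ sumBelow P (λ e → choose s e * G (P ∸ e))
  aboveZero≡sumBelow G zero    s       = refl
  aboveZero≡sumBelow G (suc P) zero    =
    sym (trans (cong₂ _+_ (ℕP.+-identityʳ (G (suc P))) (sumBelow-0 P)) (ℕP.+-identityʳ (G (suc P))))
  aboveZero≡sumBelow G (suc P) (suc s) = begin
    aboveZero G (suc P) s + aboveZero G P s
      ≡⟨ cong₂ _+_ (aboveZero≡sumBelow G (suc P) s) (aboveZero≡sumBelow G P s) ⟩
    (1 * G (suc P) + sumBelow P A) + sumBelow P B
      ≡⟨ ℕP.+-assoc (1 * G (suc P)) _ _ ⟩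
    1 * G (suc P) + (sumBelow P A + sumBelow P B)
      ≡⟨ cong (1 * G (suc P) ℕ.+_) (sym (sumBelow-+ P A B)) ⟩
    1 * G (suc P) + sumBelow P (λ e → A e + B e)
      ≡⟨ cong (1 * G (suc P) ℕ.+_) (sumBelow-cong P (λ e _ → sym (ℕP.*-distribʳ-+ (G (P ∸ e)) (choose s (suc e)) (choose s e)))) ⟩
    sumBelow (suc P) (λ e → choose (suc s) e * G (suc P ∸ e))
      ∎
    where
    open ≡-Reasoning
    A B : ℕ → ℕ
    A e = choose s (suc e) * G (P ∸ e)
    B e = choose s e * G (P ∸ e)

  -- Block tails to height 0 that meet an inadmissible vertex, each charged at the first one.
  rejected : ℕ → ℕ → ℕ → ℕ
  rejectedDown : ℕ → ℕ → ℕ → ℕ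

  rejected P c zero    = 0
  rejected P c (suc s) = (if admissibleAt P s false then rejected P (suc c) s else choose s P) + rejectedDown P c s

  rejectedDown zero    c s = 0
  rejectedDown (suc P) c s = if admissibleAt P s (r ≤ᵇ c) then rejected P 0 s else choose s P

  toZero+rejected : ∀ P c s → toZero P c s + rejected P c s ≡ choose s P
  toZero+rejected zero    c zero    = refl
  toZero+rejected (suc P) c zero    = refl
  toZero+rejected zero    c (suc s) =
    trans (cong₂ _+_ (ℕP.+-identityʳ (if v then toZero 0 (suc c) s else 0)) (ℕP.+-identityʳ (if v then rejected 0 (suc c) s else 1)))
          (if-split v (toZero+rejected 0 (suc c) s))
    where v = admissibleAt 0 s false
  toZero+rejected (suc P) c (suc s) =
    trans (interchange (toZero (suc P) (suc c) s) _ (rejected (suc P) (suc c) s) _)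
          (cong₂ _+_ (toZero+rejected (suc P) (suc c) s) (if-split (admissibleAt P s (r ≤ᵇ c)) (toZero+rejected P 0 s)))

  admissibleAt-shallow : ∀ {s} → s ≤ a → admissibleAt 0 s false ≡ true
  admissibleAt-shallow {zero}  _   = refl
  admissibleAt-shallow {suc s} s≤a = ≤⇒≤ᵇ≡true s≤a

  admissibleAt⇒shallow : ∀ s b → admissibleAt 0 s b ≡ true → s ≤ a
  admissibleAt⇒shallow zero    b _  = z≤n
  admissibleAt⇒shallow (suc s) b eq = ℕP.≤ᵇ⇒≤ (suc s) a (subst T (sym eq) _)

  rejected-level0 : ∀ c s → s ≤ a → rejected 0 c s ≡ 0
  rejected-level0 c zero    _     = refl
  rejected-level0 c (suc s) s<a =
    trans (cong (λ v → (if v then rejected 0 (suc c) s else 1) + 0) (admissibleAt-shallow (ℕP.<⇒≤ s<a)))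
          (trans (ℕP.+-identityʳ _) (rejected-level0 (suc c) s (ℕP.<⇒≤ s<a)))

  rejectedDown-level1 : ∀ c s → rejectedDown 1 c s ≡ (if admissibleAt 0 s (r ≤ᵇ c) then 0 else 1)
  rejectedDown-level1 c s with admissibleAt 0 s (r ≤ᵇ c) in eq
  ... | true  = rejected-level0 0 s (admissibleAt⇒shallow s (r ≤ᵇ c) eq)
  ... | false = refl

  -- Whether the tail U^(s−1) D from level 1 completes the forbidden pattern at height 0.
  forbiddenAtEnd : ℕ → ℕ → ℕ
  forbiddenAtEnd c zero    = 0
  forbiddenAtEnd c (suc s) = if r ≤ᵇ c + s then 1 else 0

  rejected-level1 : ∀ c s → rejected 1 c s ≡ (s ∸ suc a) + forbiddenAtEnd c s
  rejected-level1 c zero    = refl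
  rejected-level1 c (suc s) =
    trans (cong₂ _+_ (rejected-level1 (suc c) s) (rejectedDown-level1 c s)) (lastStep s)
    where
    lastStep : ∀ s → ((s ∸ suc a) + forbiddenAtEnd (suc c) s) + (if admissibleAt 0 s (r ≤ᵇ c) then 0 else 1)
                      ≡ (s ∸ a) + forbiddenAtEnd c (suc s)
    lastStep zero rewrite ℕP.0∸n≡0 a | ℕP.+-identityʳ c with r ≤ᵇ c
    ... | true  = refl
    ... | false = refl
    lastStep (suc s) = begin
      ((s ∸ a) + forbiddenAtEnd (suc c) (suc s)) + (if suc s ≤ᵇ a then 0 else 1)
        ≡⟨ cong₂ (λ x y → ((s ∸ a) + (if r ≤ᵇ x then 1 else 0)) + y) (sym (ℕP.+-suc c s)) (not-if (suc-≤ᵇ s a)) ⟩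
      ((s ∸ a) + forbiddenAtEnd c (suc (suc s))) + (if a ≤ᵇ s then 1 else 0)
        ≡⟨ xy∙z≈xz∙y (s ∸ a) _ _ ⟩
      ((s ∸ a) + (if a ≤ᵇ s then 1 else 0)) + forbiddenAtEnd c (suc (suc s))
        ≡⟨ cong (_+ forbiddenAtEnd c (suc (suc s))) (sym (suc-∸ s a)) ⟩
      (suc s ∸ a) + forbiddenAtEnd c (suc (suc s))
        ∎
      where
      open ≡-Reasoning
      not-if : ∀ {b b′} → b ≡ not b′ → (if b then 0 else 1) ≡ (if b′ then 1 else 0)
      not-if {b′ = true}  refl = refl
      not-if {b′ = false} refl = refl

  ∸≡∸-suc+forbiddenAtEnd : ∀ s → s ∸ r ≡ (s ∸ suc r) + forbiddenAtEnd 0 s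
  ∸≡∸-suc+forbiddenAtEnd zero    = ℕP.0∸n≡0 r
  ∸≡∸-suc+forbiddenAtEnd (suc s) = suc-∸ s r

  rejected-level2+ : ∀ Q c s → rejected (suc (suc Q)) c s ≡ choose (s ∸ suc a) (suc (suc Q)) + choose (s ∸ suc r) (suc Q)
  rejected-level2+ Q       c zero    = refl
  rejected-level2+ (suc Q) c (suc s) = begin
    rejected (3 + Q) (suc c) s + rejected (2 + Q) 0 s
      ≡⟨ cong₂ _+_ (rejected-level2+ (suc Q) (suc c) s) (rejected-level2+ Q 0 s) ⟩
    (choose (s ∸ suc a) (3 + Q) + choose (s ∸ suc r) (2 + Q)) + (choose (s ∸ suc a) (2 + Q) + choose (s ∸ suc r) (1 + Q))
      ≡⟨ interchange (choose (s ∸ suc a) (3 + Q)) _ _ _ ⟩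
    (choose (s ∸ suc a) (3 + Q) + choose (s ∸ suc a) (2 + Q)) + (choose (s ∸ suc r) (2 + Q) + choose (s ∸ suc r) (1 + Q))
      ≡⟨ cong₂ _+_ (choose-∸-suc s a (suc Q)) (choose-∸-suc s r Q) ⟨
    choose (s ∸ a) (3 + Q) + choose (s ∸ r) (2 + Q)
      ∎
    where open ≡-Reasoning
  rejected-level2+ zero    c (suc s) = begin
    rejected 2 (suc c) s + rejected 1 0 s
      ≡⟨ cong₂ _+_ (rejected-level2+ 0 (suc c) s) (rejected-level1 0 s) ⟩
    (choose (s ∸ suc a) 2 + choose (s ∸ suc r) 1) + ((s ∸ suc a) + forbiddenAtEnd 0 s)
      ≡⟨ cong (λ x → (choose (s ∸ suc a) 2 + choose (s ∸ suc r) 1) + (x + forbiddenAtEnd 0 s)) (sym (choose-1 (s ∸ suc a))) ⟩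
    (choose (s ∸ suc a) 2 + choose (s ∸ suc r) 1) + (choose (s ∸ suc a) 1 + forbiddenAtEnd 0 s)
      ≡⟨ interchange (choose (s ∸ suc a) 2) _ _ _ ⟩
    (choose (s ∸ suc a) 2 + choose (s ∸ suc a) 1) + (choose (s ∸ suc r) 1 + forbiddenAtEnd 0 s)
      ≡⟨ cong₂ _+_ (sym (choose-∸-suc s a 0)) (cong (_+ forbiddenAtEnd 0 s) (choose-1 (s ∸ suc r))) ⟩
    choose (s ∸ a) 2 + ((s ∸ suc r) + forbiddenAtEnd 0 s)
      ≡⟨ cong (choose (s ∸ a) 2 ℕ.+_) (sym (∸≡∸-suc+forbiddenAtEnd s)) ⟩
    choose (s ∸ a) 2 + (s ∸ r)
      ≡⟨ cong (choose (s ∸ a) 2 ℕ.+_) (sym (choose-1 (s ∸ r))) ⟩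
    choose (s ∸ a) 2 + choose (s ∸ r) 1
      ∎
    where open ≡-Reasoning

  toZero-beyond : ∀ {P} c s → s < P → toZero P c s ≡ 0
  toZero-beyond {P} c s s<P = ℕP.m+n≡0⇒m≡0 (toZero P c s) (trans (toZero+rejected P c s) (choose-< s<P))

  module FullBlock (ℓ : ℕ) (r≤ℓ : r ≤ ℓ) where

    k : ℕ
    k = suc ℓ

    toZero-fullBlock : ∀ H c → toZero (suc H) c k + choose (k ∸ suc a) (suc H) + choose (k ∸ suc r) H ≡ choose k (suc H)
    toZero-fullBlock zero c = begin
      toZero 1 c k + choose (k ∸ suc a) 1 + 1
        ≡⟨ ℕP.+-assoc (toZero 1 c k) _ 1 ⟩
      toZero 1 c k + (choose (k ∸ suc a) 1 + 1)
        ≡⟨ cong (toZero 1 c k ℕ.+_) (cong₂ _+_ (choose-1 (k ∸ suc a)) (sym (cong (λ b → if b then 1 else 0) r≤c+ℓ))) ⟩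
      toZero 1 c k + ((k ∸ suc a) + forbiddenAtEnd c k)
        ≡⟨ cong (toZero 1 c k ℕ.+_) (rejected-level1 c k) ⟨
      toZero 1 c k + rejected 1 c k
        ≡⟨ toZero+rejected 1 c k ⟩
      choose k 1
        ∎
      where
      open ≡-Reasoning
      r≤c+ℓ : (r ≤ᵇ c + ℓ) ≡ true
      r≤c+ℓ = ≤⇒≤ᵇ≡true (ℕP.≤-trans r≤ℓ (ℕP.m≤n+m ℓ c))
    toZero-fullBlock (suc Q) c =
      trans (ℕP.+-assoc (toZero (2 + Q) c k) _ _)
            (trans (cong (toZero (2 + Q) c k ℕ.+_) (sym (rejected-level2+ Q c k))) (toZero+rejected (2 + Q) c k))

    toZero-top : 1 ≤ r → ∀ c → toZero k c k ≡ 1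
    toZero-top 1≤r c = begin
      toZero k c k                                                  ≡⟨ ℕP.+-identityʳ _ ⟨
      toZero k c k + 0                                              ≡⟨ ℕP.+-identityʳ _ ⟨
      toZero k c k + 0 + 0                                          ≡⟨ cong₂ (λ x y → toZero k c k + x + y) (choose-< ℓ∸a<k) (choose-< ℓ∸r<ℓ) ⟨
      toZero k c k + choose (k ∸ suc a) k + choose (k ∸ suc r) ℓ    ≡⟨ toZero-fullBlock ℓ c ⟩
      choose k k                                                    ≡⟨ choose-n-n k ⟩
      1                                                             ∎
      where
      open ≡-Reasoning
      ℓ∸a<k : ℓ ∸ a < k
      ℓ∸a<k = s≤s (ℕP.m∸n≤m ℓ a)
      ℓ∸r<ℓ : ℓ ∸ r < ℓ
      ℓ∸r<ℓ = ℕP.∸-monoʳ-< 1≤r r≤ℓ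

-a≤ᵇ-[1+n] : ∀ a n → (ℤ.- (+ a) ℤ.≤ᵇ -[1+ n ]) ≡ (suc n ≤ᵇ a)
-a≤ᵇ-[1+n] zero    n = refl
-a≤ᵇ-[1+n] (suc a) n = sym (≤ᵇ-suc n a)

-a≤ᵇ+n : ∀ a n → (ℤ.- (+ a) ℤ.≤ᵇ + n) ≡ true
-a≤ᵇ+n zero    n = refl
-a≤ᵇ+n (suc a) n = refl

+x-+s≡+[1+x∸1+s] : ∀ {x s} → s < x → + x - + s ≡ + suc (x ∸ suc s)
+x-+s≡+[1+x∸1+s] {x} {s} s<x = trans (ℤP.m-n≡m⊖n x s) (trans (ℤP.⊖-≥ (ℕP.<⇒≤ s<x)) (cong +_ (∸≡suc∸suc s<x)))

module BlockPaths (ℓ a r m : ℕ) where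

  k : ℕ
  k = suc ℓ

  open FPaths k a r m
  open BlockCounts a r

  blockHeight : ℕ → ℕ → ℤ
  blockHeight P s = + (k * P) - + s

  blockHeight-U : ∀ P s → blockHeight P (suc s) ℤ.+ fStep-dy k U ≡ blockHeight P s
  blockHeight-U P s = lemma (+ (k * P)) (+ s)
    where
    lemma : ∀ X S → (X - (+ 1 ℤ.+ S)) ℤ.+ + 1 ≡ X - S
    lemma = ℤSolver.solve-∀

  blockHeight-D : ∀ P s → blockHeight (suc P) (suc s) ℤ.+ fStep-dy k D ≡ blockHeight P s
  blockHeight-D P s = begin
    (+ (k * suc P) - + suc s) ℤ.+ (+ 1 - + k)   ≡⟨ cong (λ z → (z - + suc s) ℤ.+ (+ 1 - + k)) (ℤP.pos-* k (suc P)) ⟩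
    (+ k ℤ.* + suc P - + suc s) ℤ.+ (+ 1 - + k) ≡⟨ lemma (+ k) (+ P) (+ s) ⟩
    + k ℤ.* + P - + s                           ≡⟨ cong (_- + s) (ℤP.pos-* k P) ⟨
    + (k * P) - + s                             ∎
    where
    open ≡-Reasoning
    lemma : ∀ K P S → (K ℤ.* (+ 1 ℤ.+ P) - (+ 1 ℤ.+ S)) ℤ.+ (+ 1 - K) ≡ K ℤ.* P - S
    lemma = ℤSolver.solve-∀

  blockHeight-D-below : a < k → ∀ s b → admissible (blockHeight 0 (suc s) ℤ.+ fStep-dy k D) b ≡ false
  blockHeight-D-below a<k s b = trans (cong (λ h → admissible h b) height) tooLow
    where
    lemma : ∀ L S → ((+ 1 ℤ.+ L) ℤ.* + 0 - (+ 1 ℤ.+ S)) ℤ.+ (+ 1 - (+ 1 ℤ.+ L)) ≡ ℤ.- (+ 1 ℤ.+ (S ℤ.+ L))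
    lemma = ℤSolver.solve-∀
    height : blockHeight 0 (suc s) ℤ.+ fStep-dy k D ≡ -[1+ s + ℓ ]
    height = trans (cong (λ z → (z - + suc s) ℤ.+ (+ 1 - + k)) (ℤP.pos-* k 0)) (lemma (+ ℓ) (+ s))
    tooLow : admissible -[1+ s + ℓ ] b ≡ false
    tooLow = cong (_∧ not (b ∧ false))
                  (trans (-a≤ᵇ-[1+n] a (s + ℓ)) (≤ᵇ≡false (s≤s (ℕP.≤-trans (ℕP.≤-pred a<k) (ℕP.m≤n+m ℓ s)))))

  admissible-blockHeight : ∀ P s b → s < k → admissible (blockHeight P s) b ≡ admissibleAt P s b
  admissible-blockHeight (suc P) s b s<k rewrite +x-+s≡+[1+x∸1+s] (ℕP.<-≤-trans s<k (ℕP.m≤m*n k (suc P))) =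
    cong₂ _∧_ (-a≤ᵇ+n a _) (cong not (∧-zeroʳ b))
  admissible-blockHeight zero zero    b _ rewrite ℕP.*-zeroʳ k = cong₂ _∧_ (-a≤ᵇ+n a 0) (cong not (∧-identityʳ b))
  admissible-blockHeight zero (suc s) b _ rewrite ℕP.*-zeroʳ k =
    trans (cong₂ _∧_ (-a≤ᵇ-[1+n] a s) (cong not (∧-zeroʳ b))) (∧-identityʳ (suc s ≤ᵇ a))

  module _ (G : ℕ → ℕ) (L : ℕ) (a<k : a < k) (extensions≡G : ∀ P c → extensions (+ (k * P)) c (k * L) ≡ G P) where

    extensions≡inBlock : ∀ s → s ≤ k → ∀ P c → extensions (blockHeight P s) c (s + k * L) ≡ inBlock G P c s
    extensions≡inBlock zero    _   P c = trans (cong (λ h → extensions h c (k * L)) (ℤP.+-identityʳ (+ (k * P)))) (extensions≡G P c)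
    extensions≡inBlock (suc s) s<k P c = cong₂ _+_ afterU (afterD P)
      where
      guarded : ∀ {h h′ c′ b b′} {x : ℕ} → h ≡ h′ → admissible h′ b ≡ b′ → extensions h′ c′ (s + k * L) ≡ x →
        admissibleExtensions h c′ b (s + k * L) ≡ (if b′ then x else 0)
      guarded refl refl refl = refl

      afterU : admissibleExtensions (blockHeight P (suc s) ℤ.+ fStep-dy k U) (suc c) false (s + k * L)
             ≡ (if admissibleAt P s false then inBlock G P (suc c) s else 0)
      afterU = guarded (blockHeight-U P s) (admissible-blockHeight P s false s<k) (extensions≡inBlock s (ℕP.<⇒≤ s<k) P (suc c))

      afterD : ∀ P → admissibleExtensions (blockHeight P (suc s) ℤ.+ fStep-dy k D) 0 (r ≤ᵇ c) (s + k * L) ≡ inBlockDown G P c s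
      afterD zero    = cong (λ v → if v then _ else 0) (blockHeight-D-below a<k s (r ≤ᵇ c))
      afterD (suc P) = guarded (blockHeight-D P s) (admissible-blockHeight P s (r ≤ᵇ c) s<k) (extensions≡inBlock s (ℕP.<⇒≤ s<k) P 0)

-- The block/step correspondence

Σℤ-tabulate : {A : Set} (n : ℕ) (f : Fin n → A) (h : A → ℤ) (g : ℕ → ℕ) →
  (∀ i → h (f i) ≡ + g (toℕ i)) → Σℤ h (tabulate f) ≡ + sumBelow n g
Σℤ-tabulate zero    f h g h∘f≡g = refl
Σℤ-tabulate (suc n) f h g h∘f≡g =
  trans (cong₂ ℤ._+_ (h∘f≡g Fin.zero) (Σℤ-tabulate n (f ∘ Fin.suc) h (g ∘ suc) (h∘f≡g ∘ Fin.suc)))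
        (sym (ℤP.pos-+ (g 0) _))

+x-+s≡-[1+s∸1+x] : ∀ {x s} → x < s → + x - + s ≡ -[1+ s ∸ suc x ]
+x-+s≡-[1+s∸1+x] {x} {s} x<s = trans (ℤP.m-n≡m⊖n x s) (trans (ℤP.⊖-< x<s) (cong (λ n → ℤ.- (+ n)) (∸≡suc∸suc x<s)))

+z+x+y-x-y≡+z : ∀ z x y → + (z + x + y) - + x - + y ≡ + z
+z+x+y-x-y≡+z z x y = begin
  + (z + x + y) - + x - + y           ≡⟨ cong (λ t → t - + x - + y) (trans (ℤP.pos-+ (z + x) y) (cong (ℤ._+ + y) (ℤP.pos-+ z x))) ⟩
  + z ℤ.+ + x ℤ.+ + y - + x - + y         ≡⟨ lemma (+ z) (+ x) (+ y) ⟩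
  + z                                     ∎
  where
  open ≡-Reasoning
  lemma : ∀ Z X Y → Z ℤ.+ X ℤ.+ Y - X - Y ≡ Z
  lemma = ℤSolver.solve-∀

module Correspondence (ℓ a r m : ℕ) (1≤r : 1 ≤ r) (r≤ℓ : r ≤ ℓ) (a<k : a < suc ℓ) where

  open BlockPaths ℓ a r m
  open FPaths k a r m
  open BlockCounts a r
  open FullBlock ℓ r≤ℓ using (toZero-fullBlock; toZero-top)
  open ColouredMotzkinPaths ℓ m (αvec k a r) (βvec k)

  toℕ≮ℓ⇒≡ℓ : ∀ (i : Fin k) → ¬ toℕ i < ℓ → toℕ i ≡ ℓ
  toℕ≮ℓ⇒≡ℓ i i≮ℓ = ℕP.≤-antisym (ℕP.≤-pred (toℕ<n i)) (ℕP.≮⇒≥ i≮ℓ)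

  α≡toZero : ∀ H c → + (k C suc H) - + ((k ∸ a ∸ 1) C suc H) - + ((k ∸ r ∸ 1) C H) ≡ + toZero (suc H) c k
  α≡toZero H c = begin
    + (k C suc H) - + ((k ∸ a ∸ 1) C suc H) - + ((k ∸ r ∸ 1) C H)
      ≡⟨ cong₂ (λ x y → + (k C suc H) - + (x C suc H) - + (y C H)) (∸-∸1 a) (∸-∸1 r) ⟩
    + (k C suc H) - + ((k ∸ suc a) C suc H) - + ((k ∸ suc r) C H)
      ≡⟨ cong₂ (λ x y → + x - + ((k ∸ suc a) C suc H) - + y) (sym (choose≡C k (suc H))) (sym (choose≡C (k ∸ suc r) H)) ⟩
    + choose k (suc H) - + ((k ∸ suc a) C suc H) - + choose (k ∸ suc r) H
      ≡⟨ cong (λ x → + choose k (suc H) - + x - + choose (k ∸ suc r) H) (sym (choose≡C (k ∸ suc a) (suc H))) ⟩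
    + choose k (suc H) - + choose (k ∸ suc a) (suc H) - + choose (k ∸ suc r) H
      ≡⟨ cong (λ t → + t - + choose (k ∸ suc a) (suc H) - + choose (k ∸ suc r) H) (sym (toZero-fullBlock H c)) ⟩
    + (toZero (suc H) c k + choose (k ∸ suc a) (suc H) + choose (k ∸ suc r) H) - + choose (k ∸ suc a) (suc H) - + choose (k ∸ suc r) H
      ≡⟨ +z+x+y-x-y≡+z (toZero (suc H) c k) (choose (k ∸ suc a) (suc H)) (choose (k ∸ suc r) H) ⟩
    + toZero (suc H) c k
      ∎
    where
    open ≡-Reasoning
    ∸-∸1 : ∀ x → k ∸ x ∸ 1 ≡ k ∸ suc x
    ∸-∸1 x = trans (ℕP.∸-+-assoc k x 1) (cong (k ∸_) (ℕP.+-comm x 1))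

  stepWeight-above : ∀ n (i : Fin k) → stepWeight (αvec k a r) (βvec k) (+ suc n) (down i) ≡ + choose k (suc (toℕ i))
  stepWeight-above n i with toℕ i ℕ.<? ℓ
  ... | yes i<ℓ = trans (cong (λ t → + (k C suc t)) (toℕ-fromℕ< i<ℓ)) (cong +_ (sym (choose≡C k (suc (toℕ i)))))
  ... | no  i≮ℓ = sym (trans (cong (λ t → + choose k (suc t)) (toℕ≮ℓ⇒≡ℓ i i≮ℓ)) (cong +_ (choose-n-n k)))

  stepWeight-atZero : ∀ c (i : Fin k) → stepWeight (αvec k a r) (βvec k) (+ 0) (down i) ≡ + toZero (suc (toℕ i)) c k
  stepWeight-atZero c i with toℕ i ℕ.<? ℓ
  ... | yes i<ℓ = trans (α≡toZero (toℕ (fromℕ< i<ℓ)) c) (cong (λ t → + toZero (suc t) c k) (toℕ-fromℕ< i<ℓ))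
  ... | no  i≮ℓ = sym (trans (cong (λ t → + toZero (suc t) c k) (toℕ≮ℓ⇒≡ℓ i i≮ℓ)) (cong +_ (toZero-top 1≤r c)))

  module OneBlock (L : ℕ) (G : ℕ → ℕ) (paths≡G : ∀ P → colouredPaths (+ P) L ≡ + G P) (H c : ℕ) where

    -- The contribution of the Motzkin step D_i from height H, which lands at H − i.
    downTerm : ℕ → ℕ
    downTerm i with ℕP.<-cmp i H
    ... | tri< _ _ _ = choose k (suc i) * G (H ∸ i)
    ... | tri≈ _ _ _ = toZero (suc H) c k * G 0
    ... | tri> _ _ _ = 0

    landing : Fin k → ℤ → ℤ
    landing i h′ = if + 0 ℤ.≤ᵇ h′ then stepWeight (αvec k a r) (βvec k) h′ (down i) ℤ.* colouredPaths h′ L else + 0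

    stepThenPaths-down : ∀ i → stepThenPaths (+ H) L (down i) ≡ + downTerm (toℕ i)
    stepThenPaths-down i with ℕP.<-cmp (toℕ i) H
    ... | tri< i<H _ _ = begin
      landing i (+ H - + toℕ i)                                 ≡⟨ cong (landing i) (+x-+s≡+[1+x∸1+s] i<H) ⟩
      landing i (+ suc (H ∸ suc (toℕ i)))                        ≡⟨ cong₂ ℤ._*_ (stepWeight-above _ i) (paths≡G _) ⟩
      + choose k (suc (toℕ i)) ℤ.* + G (suc (H ∸ suc (toℕ i)))  ≡⟨ ℤP.pos-* (choose k (suc (toℕ i))) _ ⟨
      + (choose k (suc (toℕ i)) * G (suc (H ∸ suc (toℕ i))))    ≡⟨ cong (λ n → + (choose k (suc (toℕ i)) * G n)) (∸≡suc∸suc i<H) ⟨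
      + (choose k (suc (toℕ i)) * G (H ∸ toℕ i))                ∎
      where open ≡-Reasoning
    ... | tri≈ _ refl _ = begin
      landing i (+ toℕ i - + toℕ i)                             ≡⟨ cong (landing i) (ℤP.+-inverseʳ (+ toℕ i)) ⟩
      landing i (+ 0)                                           ≡⟨ cong₂ ℤ._*_ (stepWeight-atZero c i) (paths≡G 0) ⟩
      + toZero (suc (toℕ i)) c k ℤ.* + G 0                      ≡⟨ ℤP.pos-* (toZero (suc (toℕ i)) c k) (G 0) ⟨
      + (toZero (suc (toℕ i)) c k * G 0)                        ∎
      where open ≡-Reasoning
    ... | tri> _ _ H<i = cong (landing i) (+x-+s≡-[1+s∸1+x] H<i)

    stepThenPaths-up : stepThenPaths (+ H) L up ≡ + G (suc H)
    stepThenPaths-up = trans (ℤP.*-identityˡ _) (trans (cong (λ n → colouredPaths (+ n) L) (ℕP.+-comm H 1)) (paths≡G (suc H)))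

    downTerm-below : ∀ {i} → i < H → downTerm i ≡ choose k (suc i) * G (H ∸ i)
    downTerm-below {i} i<H with ℕP.<-cmp i H
    ... | tri< _ _ _    = refl
    ... | tri≈ ¬i<H _ _ = contradiction i<H ¬i<H
    ... | tri> ¬i<H _ _ = contradiction i<H ¬i<H

    downTerm-at : downTerm H ≡ toZero (suc H) c k * G 0
    downTerm-at with ℕP.<-cmp H H
    ... | tri< _ H≢H _ = contradiction refl H≢H
    ... | tri≈ _ _ _   = refl
    ... | tri> _ H≢H _ = contradiction refl H≢H

    downTerm-above : ∀ {i} → H < i → downTerm i ≡ 0
    downTerm-above {i} H<i with ℕP.<-cmp i H
    ... | tri< _ _ ¬H<i = contradiction H<i ¬H<i
    ... | tri≈ _ _ ¬H<i = contradiction H<i ¬H<i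
    ... | tri> _ _ _    = refl

    downTerm-beyond : ∀ {i} → k ≤ i → downTerm i ≡ 0
    downTerm-beyond {i} k≤i with ℕP.<-cmp i H
    ... | tri< _ _ _    = cong (_* G (H ∸ i)) (choose-< (s≤s k≤i))
    ... | tri≈ _ refl _ = cong (_* G 0) (toZero-beyond c k (s≤s k≤i))
    ... | tri> _ _ _    = refl

    sumBelow-downTerm : sumBelow k downTerm ≡ sumBelow H (λ i → choose k (suc i) * G (H ∸ i)) + toZero (suc H) c k * G 0
    sumBelow-downTerm = begin
      sumBelow k downTerm
        ≡⟨ sameRange (ℕP.≤-total k (suc H)) ⟩
      sumBelow (suc H) downTerm
        ≡⟨ sumBelow-suc H downTerm ⟩
      sumBelow H downTerm + downTerm H
        ≡⟨ cong₂ _+_ (sumBelow-cong H (λ _ → downTerm-below)) downTerm-at ⟩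
      sumBelow H (λ i → choose k (suc i) * G (H ∸ i)) + toZero (suc H) c k * G 0
        ∎
      where
      open ≡-Reasoning
      sameRange : k ≤ suc H ⊎ suc H ≤ k → sumBelow k downTerm ≡ sumBelow (suc H) downTerm
      sameRange (inj₁ k≤1+H) = sym (sumBelow-vanishing downTerm k≤1+H (λ _ → downTerm-beyond))
      sameRange (inj₂ 1+H≤k) = sumBelow-vanishing downTerm 1+H≤k (λ _ → downTerm-above)

    inBlock≡stepThenPaths : + inBlock G (suc H) c k ≡ Σℤ (stepThenPaths (+ H) L) (mSteps ℓ)
    inBlock≡stepThenPaths = begin
      + inBlock G (suc H) c k
        ≡⟨ cong +_ (inBlock-decomposition G (suc H) c k) ⟩
      + (aboveZero G (suc H) k + toZero (suc H) c k * G 0)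
        ≡⟨ cong (λ x → + (x + toZero (suc H) c k * G 0)) (aboveZero≡sumBelow G (suc H) k) ⟩
      + ((1 * G (suc H) + sumBelow H (λ i → choose k (suc i) * G (H ∸ i))) + toZero (suc H) c k * G 0)
        ≡⟨ cong +_ (ℕP.+-assoc (1 * G (suc H)) _ _) ⟩
      + (1 * G (suc H) + (sumBelow H (λ i → choose k (suc i) * G (H ∸ i)) + toZero (suc H) c k * G 0))
        ≡⟨ cong₂ (λ x y → + (x + y)) (ℕP.*-identityˡ (G (suc H))) (sym sumBelow-downTerm) ⟩
      + (G (suc H) + sumBelow k downTerm)
        ≡⟨ ℤP.pos-+ (G (suc H)) _ ⟩
      + G (suc H) ℤ.+ + sumBelow k downTerm
        ≡⟨ cong₂ ℤ._+_ stepThenPaths-up (Σℤ-tabulate k (λ i → i) (stepThenPaths (+ H) L ∘ down) downTerm stepThenPaths-down) ⟨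
      stepThenPaths (+ H) L up ℤ.+ Σℤ (stepThenPaths (+ H) L ∘ down) (allFin k)
        ≡⟨ cong (λ x → stepThenPaths (+ H) L up ℤ.+ x) (ℤSum.sumOver-map (stepThenPaths (+ H) L) down (allFin k)) ⟨
      Σℤ (stepThenPaths (+ H) L) (mSteps ℓ)
        ∎
      where open ≡-Reasoning

  ℤeq-k*-cancel : ∀ H → ℤeq (+ (k * H)) (+ (k * m)) ≡ ℤeq (+ H) (+ m)
  ℤeq-k*-cancel H with H ℕ.≟ m
  ... | yes refl = trans (dec-true (+ (k * H) ℤ.≟ + (k * H)) refl) (sym (dec-true (+ H ℤ.≟ + H) refl))
  ... | no  H≢m  = trans (dec-false (+ (k * H) ℤ.≟ + (k * m)) (H≢m ∘ ℕP.*-cancelˡ-≡ H m k ∘ ℤP.+-injective))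
                         (sym (dec-false (+ H ℤ.≟ + m) (H≢m ∘ ℤP.+-injective)))

  +k*H≡blockHeight : ∀ H → + (k * H) ≡ blockHeight (suc H) k
  +k*H≡blockHeight H = begin
    + (k * H)                         ≡⟨ ℤP.pos-* k H ⟩
    + k ℤ.* + H                       ≡⟨ lemma (+ k) (+ H) ⟨
    + k ℤ.* (+ 1 ℤ.+ + H) - + k       ≡⟨ cong (_- + k) (ℤP.pos-* k (suc H)) ⟨
    + (k * suc H) - + k               ∎
    where
    open ≡-Reasoning
    lemma : ∀ K P → K ℤ.* (+ 1 ℤ.+ P) - K ≡ K ℤ.* P
    lemma = ℤSolver.solve-∀

  extensions≡colouredPaths : ∀ L H c → + extensions (+ (k * H)) c (k * L) ≡ colouredPaths (+ H) L
  extensions≡colouredPaths zero H c rewrite ℕP.*-zeroʳ k | ℕP.+-identityʳ H | ℤeq-k*-cancel H with ℤeq (+ H) (+ m)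
  ... | true  = refl
  ... | false = refl
  extensions≡colouredPaths (suc L) H c = begin
    + extensions (+ (k * H)) c (k * suc L)
      ≡⟨ cong₂ (λ h n → + extensions h c n) (+k*H≡blockHeight H) (ℕP.*-suc k L) ⟩
    + extensions (blockHeight (suc H) k) c (k + k * L)
      ≡⟨ cong +_ (extensions≡inBlock G L a<k extensions≡G k ℕP.≤-refl (suc H) c) ⟩
    + inBlock G (suc H) c k
      ≡⟨ OneBlock.inBlock≡stepThenPaths L G paths≡G H c ⟩
    Σℤ (stepThenPaths (+ H) L) (mSteps ℓ)
      ≡⟨ colouredPaths-suc (+ H) L ⟨
    colouredPaths (+ H) (suc L)
      ∎
    where
    open ≡-Reasoning
    G : ℕ → ℕ
    G P = extensions (+ (k * P)) 0 (k * L)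
    paths≡G : ∀ P → colouredPaths (+ P) L ≡ + G P
    paths≡G P = sym (extensions≡colouredPaths L P 0)
    extensions≡G : ∀ P c → extensions (+ (k * P)) c (k * L) ≡ G P
    extensions≡G P c = ℤP.+-injective (trans (extensions≡colouredPaths L P c) (paths≡G P))

corollary3p6 : (k : ℕ) → 2 ≤ k → (n m a r : ℕ) → m ≤ n → a ≤ k ∸ 1 → 1 ≤ r → r ≤ k ∸ 1 →
    + (F k a r n m) ≡ M (k ∸ 1) (αvec k a r) (βvec k) n m
corollary3p6 zero    ()
corollary3p6 (suc ℓ) _ n m a r _ a≤ℓ 1≤r r≤ℓ = begin
  + F (suc ℓ) a r n m                              ≡⟨ cong +_ (F≡extensions n) ⟩
  + extensions (+ 0) 0 (suc ℓ * n)                 ≡⟨ cong (λ x → + extensions (+ x) 0 (suc ℓ * n)) (ℕP.*-zeroʳ (suc ℓ)) ⟨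
  + extensions (+ (suc ℓ * 0)) 0 (suc ℓ * n)       ≡⟨ extensions≡colouredPaths n 0 0 ⟩
  colouredPaths (+ 0) n                            ≡⟨ M≡colouredPaths n ⟨
  M ℓ (αvec (suc ℓ) a r) (βvec (suc ℓ)) n m        ∎
  where
  open ≡-Reasoning
  open FPaths (suc ℓ) a r m using (F≡extensions; extensions)
  open ColouredMotzkinPaths ℓ m (αvec (suc ℓ) a r) (βvec (suc ℓ)) using (colouredPaths; M≡colouredPaths)
  open Correspondence ℓ a r m 1≤r r≤ℓ (s≤s a≤ℓ) using (extensions≡colouredPaths)
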